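{- Let $n_1\ge 2$ and let $G$ be an $n_1$-uniform hypergraph tree with at least $2$ edges. Then $l(G) \geq \mu(G)+2$.
   Context: A hypergraph $H$ is a triple $(V(H),E(H),I(H))$ with finite vertex set, finite edge set and incidence relation $I(H)\subseteq V(H)\times E(H)$; edges are treated as subsets of $V(H)$. The degree $\deg(v)$ of a vertex is the number of edges incident to it. $H$ is connected if $E(H)\neq\emptyset$ and the bipartite incidence graph on $V(H)\sqcup E(H)$ is connected; $H$ is $n_1$-uniform if every edge is incident to exactly $n_1$ vertices. A connected $n_1$-uniform hypergraph $H$ is a tree if its edges can be enumerated $e_1,\dots,e_{|E(H)|}$ so that $|e_i\cap(e_1\cup\cdots\cup e_{i-1})|=1$ for each $2\le i\le|E(H)|$. A leaf of a tree $G$ is an edge $e$ containing exactly $n_1-1$ vertices of degree $1$; $l(G)$ is the number of leaves. $\mu(G)=\sum_{v\in V(G),\,\deg(v)>2}(\deg(v)-2)$. -}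

module Defs where

open import Data.Nat using (ℕ; zero; suc; _+_; _∸_; _≤_; _<_; _<ᵇ_; _≡ᵇ_)
open import Data.Bool using (Bool; true; false; _∧_; _∨_; if_then_else_)
open import Data.Fin using (Fin; zero; suc; toℕ)
open import Data.Sum using (_⊎_; inj₁; inj₂)
open import Data.Product using (Σ; _×_; _,_; ∃)
open import Function.Bundles using (_↔_; Inverse)
open import Relation.Binary.PropositionalEquality using (_≡_)

count : ∀ {n} → (Fin n → Bool) → ℕ
count {zero}  p = 0
count {suc n} p = (if p zero then 1 else 0) + count (λ i → p (suc i))

sumFin : ∀ {n} → (Fin n → ℕ) → ℕ
sumFin {zero}  f = 0
sumFin {suc n} f = f zero + sumFin (λ i → f (suc i))

anyFin : ∀ {n} → (Fin n → Bool) → Bool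
anyFin {zero}  p = false
anyFin {suc n} p = p zero ∨ anyFin (λ i → p (suc i))

record Hypergraph : Set where
  field
    nv  : ℕ
    ne  : ℕ
    inc : Fin nv → Fin ne → Bool

module _ (H : Hypergraph) where
  open Hypergraph H

  edgeSize : Fin ne → ℕ
  edgeSize e = count (λ v → inc v e)

  deg : Fin nv → ℕ
  deg v = count (λ e → inc v e)

  Uniform : ℕ → Set
  Uniform n₁ = ∀ (e : Fin ne) → edgeSize e ≡ n₁

  -- incidence (bipartite) graph on V ⊎ E
  data Adj : Fin nv ⊎ Fin ne → Fin nv ⊎ Fin ne → Set where
    ve : ∀ v e → inc v e ≡ true → Adj (inj₁ v) (inj₂ e)
    ev : ∀ v e → inc v e ≡ true → Adj (inj₂ e) (inj₁ v)

  data Reach : Fin nv ⊎ Fin ne → Fin nv ⊎ Fin ne → Set where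
    here : ∀ x → Reach x x
    step : ∀ {x y z} → Adj x y → Reach y z → Reach x z

  Connected : Set
  Connected = (1 ≤ ne) × (∀ x y → Reach x y)

  overlapPrev : (Fin ne → Fin ne) → Fin ne → ℕ
  overlapPrev σ i =
    count (λ v → inc v (σ i) ∧ anyFin (λ j → (toℕ j <ᵇ toℕ i) ∧ inc v (σ j)))

  IsTree : ℕ → Set
  IsTree n₁ = Connected × Uniform n₁ ×
    Σ (Fin ne ↔ Fin ne) (λ σ → ∀ (i : Fin ne) → 1 ≤ toℕ i →
        overlapPrev (Inverse.to σ) i ≡ 1)

  isLeaf : ℕ → Fin ne → Bool
  isLeaf n₁ e = count (λ v → inc v e ∧ (deg v ≡ᵇ 1)) ≡ᵇ (n₁ ∸ 1)

  leaves : ℕ → ℕ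
  leaves n₁ = count (isLeaf n₁)

  μ : ℕ
  μ = sumFin (λ v → if 2 <ᵇ deg v then deg v ∸ 2 else 0)

module Submission where

-- For an n₁-uniform hypergraph tree G with m ≥ 2 edges we show  μ(G) + 2 ≤ l(G).
-- Call a vertex a branch vertex if its degree is at least 2; let N be their number.
--
-- Adding the edges in tree order, every edge after the first meets
--     the earlier ones in exactly one vertex, so  Σ_v (deg v − 1) = m − 1.  Splitting
--     deg v − 1 vertex by vertex gives  μ + N = m − 1.
-- (2) Edge bound.  With m ≥ 2 every edge meets another edge, hence contains a branch
--     vertex; an edge with a single branch vertex has n₁ − 1 vertices of degree 1, so it
--     is a leaf.  Summing  2 ≤ (branch vertices of e) + [e is a leaf]  over the edges and
--     double counting edge/branch-vertex incidences:  2m ≤ Σ_{v branch} deg v + l,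
--     and  Σ_{v branch} deg v = (m − 1) + N.
-- (3) Hence  2(μ + N + 1) ≤ (μ + N) + N + l,  i.e.  μ + 2 ≤ l.

open import Defs
open import Data.Nat using (ℕ; zero; suc; _+_; _*_; _∸_; _≤_; _<_; _<ᵇ_; _≡ᵇ_; z≤n; s≤s)
open import Data.Nat.Properties
open import Data.Bool using (Bool; true; false; T; _∧_; if_then_else_)
open import Data.Bool.Properties using (∧-identityʳ; ∧-zeroʳ; T-∧)
open import Data.Fin using (Fin; zero; suc; toℕ; fromℕ<)
open import Data.Fin.Properties using (toℕ-fromℕ<; toℕ-injective)
open import Data.Product using (_×_; _,_; ∃; ∃₂; map)
open import Data.Empty using (⊥-elim)
open import Function using (_∘_; id; _↔_; Inverse; Equivalence)
open import Relation.Binary.PropositionalEquality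
open import Algebra.Properties.CommutativeMonoid.Sum +-0-commutativeMonoid
  using (sum-syntax; sum-cong-≗; sum-replicate-zero; ∑-distrib-+; ∑-comm; ∑-permute)
open import Data.Nat.Solver using (module +-*-Solver)
open +-*-Solver using (solve; _:+_; _:*_; _:=_; con)
open ≡-Reasoning

ind : Bool → ℕ
ind b = if b then 1 else 0

ind-T : ∀ {b} → T b → ind b ≡ 1
ind-T {true} _ = refl

sumFin≡∑ : ∀ {n} (f : Fin n → ℕ) → sumFin f ≡ ∑[ i < n ] f i
sumFin≡∑ {zero}  f = refl
sumFin≡∑ {suc n} f = cong (f zero +_) (sumFin≡∑ (f ∘ suc))

count≡∑ : ∀ {n} (p : Fin n → Bool) → count p ≡ ∑[ i < n ] ind (p i)
count≡∑ {zero}  p = refl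
count≡∑ {suc n} p = cong (ind (p zero) +_) (count≡∑ (p ∘ suc))

∑-mono : ∀ {n} {f g : Fin n → ℕ} → (∀ i → f i ≤ g i) → ∑[ i < n ] f i ≤ ∑[ i < n ] g i
∑-mono {zero}  f≤g = z≤n
∑-mono {suc n} f≤g = +-mono-≤ (f≤g zero) (∑-mono (f≤g ∘ suc))

∑-const : ∀ n c → ∑[ i < n ] c ≡ n * c
∑-const zero    c = refl
∑-const (suc n) c = cong (c +_) (∑-const n c)

∑-ind-∧ : ∀ {n} (p : Fin n → Bool) b → ∑[ i < n ] ind (p i ∧ b) ≡ (if b then count p else 0)
∑-ind-∧     p true  = trans (sum-cong-≗ (cong ind ∘ ∧-identityʳ ∘ p)) (sym (count≡∑ p))
∑-ind-∧ {n} p false = trans (sum-cong-≗ (cong ind ∘ ∧-zeroʳ ∘ p)) (sum-replicate-zero n)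

count-cong : ∀ {n} {p q : Fin n → Bool} → (∀ i → p i ≡ q i) → count p ≡ count q
count-cong {zero}  p≗q = refl
count-cong {suc n} p≗q = cong₂ _+_ (cong ind (p≗q zero)) (count-cong (p≗q ∘ suc))

count-false : ∀ {n} → count {n} (λ _ → false) ≡ 0
count-false {zero}  = refl
count-false {suc n} = count-false {n}

ind≤count : ∀ {n} (p : Fin n → Bool) i → ind (p i) ≤ count p
ind≤count p zero    = m≤m+n _ _
ind≤count p (suc i) = ≤-trans (ind≤count (p ∘ suc) i) (m≤n+m _ _)

count-pos : ∀ {n} (p : Fin n → Bool) i → T (p i) → 1 ≤ count p
count-pos p i pi = subst (_≤ count p) (ind-T pi) (ind≤count p i)

count-two : ∀ {n} (p : Fin n → Bool) {i j} → i ≢ j → T (p i) → T (p j) → 2 ≤ count p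
count-two p {zero}  {zero}  i≢j _  _  = ⊥-elim (i≢j refl)
count-two p {zero}  {suc j} _   pi pj = +-mono-≤ (≤-reflexive (sym (ind-T pi))) (count-pos (p ∘ suc) j pj)
count-two p {suc i} {zero}  _   pi pj = +-mono-≤ (≤-reflexive (sym (ind-T pj))) (count-pos (p ∘ suc) i pi)
count-two p {suc i} {suc j} i≢j pi pj =
  ≤-trans (count-two (p ∘ suc) (i≢j ∘ cong suc) pi pj) (m≤n+m _ (ind (p zero)))

count-witness : ∀ {n} (p : Fin n → Bool) → 1 ≤ count p → ∃ λ i → T (p i)
count-witness {suc n} p h with p zero in p₀
... | true  = zero , subst T (sym p₀) _
... | false = map suc id (count-witness (p ∘ suc) h)

anyFin≡count : ∀ {n} (p : Fin n → Bool) → anyFin p ≡ (0 <ᵇ count p)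
anyFin≡count {zero}  p = refl
anyFin≡count {suc n} p with p zero
... | true  = refl
... | false = anyFin≡count (p ∘ suc)

anyFin-false : ∀ {n} → anyFin {n} (λ _ → false) ≡ false
anyFin-false {zero}  = refl
anyFin-false {suc n} = anyFin-false {n}

anyFin-witness : ∀ {n} (p : Fin n → Bool) → T (anyFin p) → ∃ λ i → T (p i)
anyFin-witness p any = count-witness p (<ᵇ⇒< 0 (count p) (subst T (anyFin≡count p) any))

count-below-suc : ∀ {n} (p : Fin n → Bool) (i : Fin n) →
  count (λ j → (toℕ j <ᵇ suc (toℕ i)) ∧ p j) ≡ count (λ j → (toℕ j <ᵇ toℕ i) ∧ p j) + ind (p i)
count-below-suc {suc n} p zero    rewrite count-false {n} = +-comm (ind (p zero)) 0
count-below-suc {suc n} p (suc i) rewrite count-below-suc (p ∘ suc) i = sym (+-assoc (ind (p zero)) _ _)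

count-below-all : ∀ {n} (p : Fin n → Bool) → count (λ j → (toℕ j <ᵇ n) ∧ p j) ≡ count p
count-below-all {zero}  p = refl
count-below-all {suc n} p = cong (ind (p zero) +_) (count-below-all (p ∘ suc))

-- Adding an edge to a vertex of current degree d raises d ∸ 1 exactly when d was positive.
truncated-step : ∀ d b → (d + ind b) ∸ 1 ≡ (d ∸ 1) + ind (b ∧ (0 <ᵇ d))
truncated-step d       false = trans (cong (_∸ 1) (+-identityʳ d)) (sym (+-identityʳ (d ∸ 1)))
truncated-step zero    true  = refl
truncated-step (suc d) true  = refl

degree-one-or-branch : ∀ d → 1 ≤ d → ind (d ≡ᵇ 1) + ind (1 <ᵇ d) ≡ 1
degree-one-or-branch (suc zero)    _ = refl
degree-one-or-branch (suc (suc d)) _ = refl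

ind-∧-split : ∀ a b c → (T a → ind b + ind c ≡ 1) → ind (a ∧ b) + ind (a ∧ c) ≡ ind a
ind-∧-split true  b c split = split _
ind-∧-split false b c split = refl

excess-split : ∀ d → (if 2 <ᵇ d then d ∸ 2 else 0) + ind (1 <ᵇ d) ≡ d ∸ 1
excess-split zero                = refl
excess-split (suc zero)          = refl
excess-split (suc (suc zero))    = refl
excess-split (suc (suc (suc d))) = +-comm (suc d) 1

branch-degree : ∀ d → (if 1 <ᵇ d then d else 0) ≡ (d ∸ 1) + ind (1 <ᵇ d)
branch-degree zero          = refl
branch-degree (suc zero)    = refl
branch-degree (suc (suc d)) = +-comm 1 (suc d)

two-or-leaf : ∀ {c k n} → c + k ≡ n → 1 ≤ k → 2 ≤ k + ind (c ≡ᵇ (n ∸ 1))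
two-or-leaf {c} {suc zero}    refl _ = s≤s (≤-reflexive (sym (ind-T (≡⇒≡ᵇ c (c + 1 ∸ 1) (sym (m+n∸n≡m c 1))))))
two-or-leaf {c} {suc (suc k)} refl _ = s≤s (s≤s z≤n)

-- The final inequality, with S = M + N standing for Σ_v (deg v ∸ 1) and m = S + 1.
leaf-arith : ∀ {M N S m l} → M + N ≡ S → S + 1 ≡ m → m * 2 ≤ (S + N) + l → M + 2 ≤ l
leaf-arith {M} {N} {l = l} refl refl bound =
  +-cancelˡ-≤ (M + N + N) (M + 2) l (subst (_≤ (M + N + N) + l) regroup bound)
  where
    regroup : (M + N + 1) * 2 ≡ (M + N + N) + (M + 2)
    regroup = solve 2 (λ M N → (M :+ N :+ con 1) :* con 2 := (M :+ N :+ N) :+ (M :+ con 2)) refl M N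

SharesVertex : (H : Hypergraph) → Fin (Hypergraph.ne H) → Set
SharesVertex H e = ∃₂ λ v e' → e' ≢ e × T (inc v e) × T (inc v e')
  where open Hypergraph H

module Branching (H : Hypergraph) where
  open Hypergraph H

  isBranch : Fin nv → Bool
  isBranch v = 1 <ᵇ deg H v

  branchCount : Fin ne → ℕ
  branchCount e = count (λ v → inc v e ∧ isBranch v)

  branchDegreeSum : ℕ
  branchDegreeSum = ∑[ v < nv ] (if isBranch v then deg H v else 0)

  branchCount-pos : ∀ {v e e'} → e' ≢ e → T (inc v e) → T (inc v e') → 1 ≤ branchCount e
  branchCount-pos {v} {e} e'≢e in-e in-e' =
    count-pos (λ w → inc w e ∧ isBranch w) v (Equivalence.from T-∧ (in-e , v-is-branch))
    where
      v-is-branch : T (isBranch v)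
      v-is-branch = <⇒<ᵇ (count-two (inc v) (e'≢e ∘ sym) in-e in-e')

  edge-split : ∀ e → count (λ v → inc v e ∧ (deg H v ≡ᵇ 1)) + branchCount e ≡ edgeSize H e
  edge-split e = begin
    count (λ v → inc v e ∧ (deg H v ≡ᵇ 1)) + branchCount e
      ≡⟨ cong₂ _+_ (count≡∑ (λ v → inc v e ∧ (deg H v ≡ᵇ 1))) (count≡∑ (λ v → inc v e ∧ isBranch v)) ⟩
    ∑[ v < nv ] ind (inc v e ∧ (deg H v ≡ᵇ 1)) + ∑[ v < nv ] ind (inc v e ∧ isBranch v)
      ≡⟨ sym (∑-distrib-+ (λ v → ind (inc v e ∧ (deg H v ≡ᵇ 1))) (λ v → ind (inc v e ∧ isBranch v))) ⟩
    ∑[ v < nv ] (ind (inc v e ∧ (deg H v ≡ᵇ 1)) + ind (inc v e ∧ isBranch v))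
      ≡⟨ sum-cong-≗ (λ v → ind-∧-split (inc v e) _ _ (degree-one-or-branch (deg H v) ∘ count-pos (inc v) e)) ⟩
    ∑[ v < nv ] ind (inc v e)
      ≡⟨ sym (count≡∑ (λ v → inc v e)) ⟩
    edgeSize H e ∎

  branch-or-leaf : ∀ {n₁} → Uniform H n₁ → ∀ e → 1 ≤ branchCount e →
    2 ≤ branchCount e + ind (isLeaf H n₁ e)
  branch-or-leaf uniform e = two-or-leaf (trans (edge-split e) (uniform e))

  branchCount-sum : ∑[ e < ne ] branchCount e ≡ branchDegreeSum
  branchCount-sum = begin
    ∑[ e < ne ] branchCount e
      ≡⟨ sum-cong-≗ (λ e → count≡∑ (λ v → inc v e ∧ isBranch v)) ⟩
    ∑[ e < ne ] ∑[ v < nv ] ind (inc v e ∧ isBranch v)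
      ≡⟨ ∑-comm (λ e v → ind (inc v e ∧ isBranch v)) ⟩
    ∑[ v < nv ] ∑[ e < ne ] ind (inc v e ∧ isBranch v)
      ≡⟨ sum-cong-≗ (λ v → ∑-ind-∧ (inc v) (isBranch v)) ⟩
    branchDegreeSum ∎

  edge-bound : ∀ {n₁} → Uniform H n₁ → (∀ e → SharesVertex H e) →
    ne * 2 ≤ branchDegreeSum + leaves H n₁
  edge-bound {n₁} uniform meets = subst₂ _≤_ (∑-const ne 2) total (∑-mono per-edge)
    where
      per-edge : ∀ e → 2 ≤ branchCount e + ind (isLeaf H n₁ e)
      per-edge e with meets e
      ... | _ , _ , e'≢e , in-e , in-e' = branch-or-leaf uniform e (branchCount-pos e'≢e in-e in-e')

      total : ∑[ e < ne ] (branchCount e + ind (isLeaf H n₁ e)) ≡ branchDegreeSum + leaves H n₁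
      total = trans (∑-distrib-+ branchCount (ind ∘ isLeaf H n₁))
                    (cong₂ _+_ branchCount-sum (sym (count≡∑ (isLeaf H n₁))))

  excess-identity : μ H + ∑[ v < nv ] ind (isBranch v) ≡ ∑[ v < nv ] (deg H v ∸ 1)
  excess-identity = begin
    μ H + ∑[ v < nv ] ind (isBranch v)
      ≡⟨ cong (_+ ∑[ v < nv ] ind (isBranch v)) (sumFin≡∑ μ-part) ⟩
    ∑[ v < nv ] μ-part v + ∑[ v < nv ] ind (isBranch v)
      ≡⟨ sym (∑-distrib-+ μ-part (ind ∘ isBranch)) ⟩
    ∑[ v < nv ] (μ-part v + ind (isBranch v))
      ≡⟨ sum-cong-≗ (excess-split ∘ deg H) ⟩
    ∑[ v < nv ] (deg H v ∸ 1) ∎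
    where
      μ-part : Fin nv → ℕ
      μ-part v = if 2 <ᵇ deg H v then deg H v ∸ 2 else 0

  branchDegreeSum-split : branchDegreeSum ≡ ∑[ v < nv ] (deg H v ∸ 1) + ∑[ v < nv ] ind (isBranch v)
  branchDegreeSum-split =
    trans (sum-cong-≗ (branch-degree ∘ deg H)) (∑-distrib-+ (λ v → deg H v ∸ 1) (ind ∘ isBranch))

module Enumeration (H : Hypergraph) (τ : Fin (Hypergraph.ne H) → Fin (Hypergraph.ne H)) where
  open Hypergraph H

  prefixDeg : ℕ → Fin nv → ℕ
  prefixDeg k v = count (λ j → (toℕ j <ᵇ k) ∧ inc v (τ j))

  prefixExcess : ℕ → ℕ
  prefixExcess k = ∑[ v < nv ] (prefixDeg k v ∸ 1)

  prefixExcess-zero : prefixExcess 0 ≡ 0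
  prefixExcess-zero = trans (sum-cong-≗ {nv} (λ v → cong (_∸ 1) (count-false {ne}))) (sum-replicate-zero nv)

  prefixExcess-step : ∀ i → prefixExcess (suc (toℕ i)) ≡ prefixExcess (toℕ i) + overlapPrev H τ i
  prefixExcess-step i = begin
    ∑[ v < nv ] (prefixDeg (suc (toℕ i)) v ∸ 1)
      ≡⟨ sum-cong-≗ (λ v → cong (_∸ 1) (count-below-suc (λ j → inc v (τ j)) i)) ⟩
    ∑[ v < nv ] ((prefixDeg (toℕ i) v + ind (inc v (τ i))) ∸ 1)
      ≡⟨ sum-cong-≗ (λ v → truncated-step (prefixDeg (toℕ i) v) (inc v (τ i))) ⟩
    ∑[ v < nv ] ((prefixDeg (toℕ i) v ∸ 1) + ind (inc v (τ i) ∧ (0 <ᵇ prefixDeg (toℕ i) v)))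
      ≡⟨ ∑-distrib-+ (λ v → prefixDeg (toℕ i) v ∸ 1) (λ v → ind (inc v (τ i) ∧ (0 <ᵇ prefixDeg (toℕ i) v))) ⟩
    prefixExcess (toℕ i) + ∑[ v < nv ] ind (inc v (τ i) ∧ (0 <ᵇ prefixDeg (toℕ i) v))
      ≡⟨ cong (prefixExcess (toℕ i) +_) (sym overlap≡) ⟩
    prefixExcess (toℕ i) + overlapPrev H τ i ∎
    where
      overlap≡ : overlapPrev H τ i ≡ ∑[ v < nv ] ind (inc v (τ i) ∧ (0 <ᵇ prefixDeg (toℕ i) v))
      overlap≡ = trans (count≡∑ (λ v → inc v (τ i) ∧ anyFin (λ j → (toℕ j <ᵇ toℕ i) ∧ inc v (τ j))))
        (sum-cong-≗ (λ v → cong (λ b → ind (inc v (τ i) ∧ b)) (anyFin≡count (λ j → (toℕ j <ᵇ toℕ i) ∧ inc v (τ j)))))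

  prefixExcess-step-at : ∀ k (k<ne : k < ne) →
    prefixExcess (suc k) ≡ prefixExcess k + overlapPrev H τ (fromℕ< k<ne)
  prefixExcess-step-at k k<ne =
    subst (λ x → prefixExcess (suc x) ≡ prefixExcess x + overlapPrev H τ (fromℕ< k<ne))
          (toℕ-fromℕ< k<ne) (prefixExcess-step (fromℕ< k<ne))

  overlap-first : ∀ i → toℕ i ≡ 0 → overlapPrev H τ i ≡ 0
  overlap-first i i≡0 = trans (count-cong nothing-earlier) (count-false {nv})
    where
      nothing-earlier : ∀ v → (inc v (τ i) ∧ anyFin (λ j → (toℕ j <ᵇ toℕ i) ∧ inc v (τ j))) ≡ false
      nothing-earlier v rewrite i≡0 | anyFin-false {ne} = ∧-zeroʳ (inc v (τ i))

module TreeEnumeration (H : Hypergraph) (σ : Fin (Hypergraph.ne H) ↔ Fin (Hypergraph.ne H))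
  (tree-order : ∀ i → 1 ≤ toℕ i → overlapPrev H (Inverse.to σ) i ≡ 1) where
  open Hypergraph H
  open Inverse σ using (from; strictlyInverseˡ; strictlyInverseʳ) renaming (to to τ)
  open Enumeration H τ

  prefixExcess-tree : ∀ k → k < ne → prefixExcess (suc k) ≡ k
  prefixExcess-tree zero 0<ne = begin
    prefixExcess 1                                        ≡⟨ prefixExcess-step-at 0 0<ne ⟩
    prefixExcess 0 + overlapPrev H τ (fromℕ< 0<ne)        ≡⟨ cong₂ _+_ prefixExcess-zero (overlap-first _ (toℕ-fromℕ< 0<ne)) ⟩
    0                                                     ∎
  prefixExcess-tree (suc k) k<ne = begin
    prefixExcess (suc (suc k))                            ≡⟨ prefixExcess-step-at (suc k) k<ne ⟩
    prefixExcess (suc k) + overlapPrev H τ (fromℕ< k<ne)  ≡⟨ cong₂ _+_ (prefixExcess-tree k (<-trans (n<1+n k) k<ne)) later ⟩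
    k + 1                                                 ≡⟨ +-comm k 1 ⟩
    suc k                                                 ∎
    where
      later : overlapPrev H τ (fromℕ< k<ne) ≡ 1
      later = tree-order _ (subst (1 ≤_) (sym (toℕ-fromℕ< k<ne)) (s≤s z≤n))

  prefixDeg-all : ∀ v → prefixDeg ne v ≡ deg H v
  prefixDeg-all v = begin
    prefixDeg ne v                   ≡⟨ count-below-all (λ j → inc v (τ j)) ⟩
    count (λ j → inc v (τ j))        ≡⟨ count≡∑ (λ j → inc v (τ j)) ⟩
    ∑[ j < ne ] ind (inc v (τ j))    ≡⟨ sym (∑-permute (λ e → ind (inc v e)) σ) ⟩
    ∑[ e < ne ] ind (inc v e)        ≡⟨ sym (count≡∑ (inc v)) ⟩
    deg H v                          ∎

  excess-sum : 1 ≤ ne → ∑[ v < nv ] (deg H v ∸ 1) + 1 ≡ ne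
  excess-sum 1≤ne = begin
    ∑[ v < nv ] (deg H v ∸ 1) + 1  ≡⟨ cong (_+ 1) (sum-cong-≗ (λ v → cong (_∸ 1) (sym (prefixDeg-all v)))) ⟩
    prefixExcess ne + 1            ≡⟨ cong (λ k → prefixExcess k + 1) (sym suc-k≡ne) ⟩
    prefixExcess (suc k) + 1       ≡⟨ cong (_+ 1) (prefixExcess-tree k (≤-reflexive suc-k≡ne)) ⟩
    k + 1                          ≡⟨ +-comm k 1 ⟩
    suc k                          ≡⟨ suc-k≡ne ⟩
    ne                             ∎
    where
      k = ne ∸ 1
      suc-k≡ne : suc k ≡ ne
      suc-k≡ne = m+[n∸m]≡n 1≤ne

  meets-earlier : ∀ i → 1 ≤ toℕ i → ∃₂ λ v j → toℕ j < toℕ i × T (inc v (τ i)) × T (inc v (τ j))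
  meets-earlier i 1≤i =
    let v , shared     = count-witness (λ v → inc v (τ i) ∧ earlier-edge v) (≤-reflexive (sym (tree-order i 1≤i)))
        in-i , earlier = Equivalence.to T-∧ shared
        j , before     = anyFin-witness (λ j → (toℕ j <ᵇ toℕ i) ∧ inc v (τ j)) earlier
        j<i , in-j     = Equivalence.to T-∧ before
    in v , j , <ᵇ⇒< _ _ j<i , in-i , in-j
    where
      earlier-edge : Fin nv → Bool
      earlier-edge v = anyFin (λ j → (toℕ j <ᵇ toℕ i) ∧ inc v (τ j))

  second-meets-first : (2≤ne : 2 ≤ ne) → ∀ p → toℕ p ≡ 0 →
    ∃ λ v → T (inc v (τ p)) × T (inc v (τ (fromℕ< 2≤ne)))
  second-meets-first 2≤ne p p≡0 with meets-earlier (fromℕ< 2≤ne) (≤-reflexive (sym (toℕ-fromℕ< 2≤ne)))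
  ... | v , q , q<1 , in-second , in-q = v , subst (T ∘ inc v ∘ τ) q≡p in-q , in-second
    where
      q≡p : q ≡ p
      q≡p = toℕ-injective (trans (n<1⇒n≡0 (subst (toℕ q <_) (toℕ-fromℕ< 2≤ne) q<1)) (sym p≡0))

  meets-other : 2 ≤ ne → ∀ p → ∃₂ λ v q → q ≢ p × T (inc v (τ p)) × T (inc v (τ q))
  meets-other 2≤ne p with toℕ p in p≡
  ... | suc _ with meets-earlier p (subst (1 ≤_) (sym p≡) (s≤s z≤n))
  ...   | v , q , q<p , in-p , in-q = v , q , (λ q≡p → <-irrefl (cong toℕ q≡p) q<p) , in-p , in-q
  meets-other 2≤ne p | zero with second-meets-first 2≤ne p p≡
  ...   | v , in-p , in-second = v , fromℕ< 2≤ne , second≢p , in-p , in-second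
    where
      second≢p : fromℕ< 2≤ne ≢ p
      second≢p second≡p = 1+n≢0 (trans (sym (toℕ-fromℕ< 2≤ne)) (trans (cong toℕ second≡p) p≡))

  shares-vertex : 2 ≤ ne → ∀ e → SharesVertex H e
  shares-vertex 2≤ne e with meets-other 2≤ne (from e)
  ... | v , q , q≢p , in-p , in-q =
    v , τ q , (λ τq≡e → q≢p (trans (sym (strictlyInverseʳ q)) (cong from τq≡e))) ,
    subst (T ∘ inc v) (strictlyInverseˡ e) in-p , in-q

-- The theorem: combine (1) and (2) by leaf-arith.
lemma2p1 : (n₁ : ℕ) → 2 ≤ n₁ → (G : Hypergraph) → IsTree G n₁ →
    2 ≤ Hypergraph.ne G → μ G + 2 ≤ leaves G n₁
lemma2p1 n₁ _ G (_ , uniform , σ , tree-order) 2≤m =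
  leaf-arith excess-identity (excess-sum (≤-trans (s≤s z≤n) 2≤m))
    (subst (λ s → ne * 2 ≤ s + leaves G n₁) branchDegreeSum-split
      (edge-bound uniform (shares-vertex 2≤m)))
  where
    open Hypergraph G using (ne)
    open Branching G
    open TreeEnumeration G σ tree-order
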